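{- Let $\phi$ be an additive functorial interpretation of a polygraphic program $\Pi$. For every function $2$-cell $f$ and every value $t$ of type $s_1f$, one has $\partial_\phi(t\star_1f)=\partial_\phi f\circ\phi(t)$.
   Context: A polygraphic program is a finite 3-polygraph with a single $0$-cell $\ast$ whose $2$-cells split into structure $2$-cells ($\tau_{\xi,\zeta}:\xi\zeta\Rightarrow\zeta\xi$, $\delta_\xi:\xi\Rightarrow\xi\xi$, $\epsilon_\xi:\xi\Rightarrow\ast$), constructor $2$-cells (target a single $1$-cell) and function $2$-cells. $2$-paths compose by $\star_0$ and $\star_1$; $s_1f$ is the $1$-source. A value of type $u$ is a $2$-path $\ast\Rightarrow u$ built only from constructor $2$-cells. A functorial interpretation $\phi$ assigns to each $1$-path $u$ with $n$ $1$-cells a nonempty $\phi(u)\subseteq(\mathbb{N}\setminus\{0\})^n$ ($\phi(\ast)$ a singleton) and to each $2$-path $f:u\Rightarrow v$ a monotone map $\phi(f):\phi(u)\to\phi(v)$, with $\phi(u\star_0v)=\phi(u)\times\phi(v)$, $\phi(f\star_0g)=\phi(f)\times\phi(g)$, $\phi(f\star_1g)=\phi(g)\circ\phi(f)$, identities to identities. It is additive if for every constructor $c$ of arity $n$ there is an integer $c_c\ge1$ with $\phi(c)(x_1,\dots,x_n)=x_1+\dots+x_n+c_c$. $\partial_\phi$ assigns to each $2$-path $f$ with $1$-source $u$ a map $\partial_\phi f:\phi(u)\to\mathbb{N}$, determined by $\partial_\phi(\text{identity})=0$, $\partial_\phi(f\star_0g)(x,y)=\max\{\partial_\phi f(x),\partial_\phi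 g(y)\}$, $\partial_\phi(f\star_1g)=\max\{\partial_\phi f,\partial_\phi g\circ\phi(f)\}$ and, for each $2$-cell $c$ of arity $m$ and coarity $n$, $\partial_\phi c(x_1,\dots,x_m)=\max\{x_1,\dots,x_m,y_1,\dots,y_n\}$ with $(y_1,\dots,y_n)=\phi(c)(x)$. -}

module Defs where

open import Data.Nat using (ℕ; zero; suc; _+_; _≤_; _⊔_)
open import Data.Fin using (Fin)
open import Data.List using (List; []; _∷_; _++_; foldr)
open import Data.List.Relation.Unary.All using (All; []; _∷_; head)
open import Data.List.Relation.Unary.All.Properties using (++⁺; ++⁻)
open import Data.Product using (Σ; ∃; _×_; _,_; proj₁; proj₂)
open import Data.Unit using (⊤)
open import Relation.Binary.PropositionalEquality using (_≡_)

-- The 2-dimensional part of a polygraphic program: a single 0-cell *,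
-- finitely many 1-cells (Fin n1), constructor 2-cells (target a single
-- 1-cell) and function 2-cells.  1-paths are lists of 1-cells, the empty
-- list being the identity 1-path on *.

record Sig : Set where
  field
    n1     : ℕ
    nc     : ℕ
    nf     : ℕ
    conSrc : Fin nc → List (Fin n1)
    conTgt : Fin nc → Fin n1
    funSrc : Fin nf → List (Fin n1)
    funTgt : Fin nf → List (Fin n1)

module _ (S : Sig) where
  open Sig S

  Path1 : Set
  Path1 = List (Fin n1)

  data Cell2 : Path1 → Path1 → Set where
    τ   : (ξ ζ : Fin n1) → Cell2 (ξ ∷ ζ ∷ []) (ζ ∷ ξ ∷ [])
    δ   : (ξ : Fin n1) → Cell2 (ξ ∷ []) (ξ ∷ ξ ∷ [])
    ε   : (ξ : Fin n1) → Cell2 (ξ ∷ []) []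
    con : (c : Fin nc) → Cell2 (conSrc c) (conTgt c ∷ [])
    fun : (f : Fin nf) → Cell2 (funSrc f) (funTgt f)

  data Path2 : Path1 → Path1 → Set where
    cell : ∀ {u v} → Cell2 u v → Path2 u v
    idp  : (u : Path1) → Path2 u u
    _⋆₀_ : ∀ {u v u' v'} → Path2 u v → Path2 u' v' → Path2 (u ++ u') (v ++ v')
    _⋆₁_ : ∀ {u v w} → Path2 u v → Path2 v w → Path2 u w

  data OnlyCons : ∀ {u v} → Path2 u v → Set where
    con-c : (c : Fin nc) → OnlyCons (cell (con c))
    id-c  : (u : Path1) → OnlyCons (idp u)
    ⋆₀-c  : ∀ {u v u' v'} {p : Path2 u v} {q : Path2 u' v'} →
            OnlyCons p → OnlyCons q → OnlyCons (p ⋆₀ q)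
    ⋆₁-c  : ∀ {u v w} {p : Path2 u v} {q : Path2 v w} →
            OnlyCons p → OnlyCons q → OnlyCons (p ⋆₁ q)

  IsValue : ∀ {u} → Path2 [] u → Set
  IsValue t = OnlyCons t

-- A 3-polygraph: the 2-polygraph above plus finitely many 3-cells
-- between parallel 2-paths (irrelevant for the statement but part of
-- the data of a program).
record Program : Set where
  field
    sig : Sig
    n3  : ℕ
    s3₁ : Fin n3 → Path1 sig
    t3₁ : Fin n3 → Path1 sig
    src3 : (a : Fin n3) → Path2 sig (s3₁ a) (t3₁ a)
    tgt3 : (a : Fin n3) → Path2 sig (s3₁ a) (t3₁ a)

module _ {S : Sig} where
  open Sig S

  module Carriers (dom : Fin n1 → ℕ → Set) where
    El : Path1 S → Set
    El u = All (λ ξ → Σ ℕ (dom ξ)) u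

    _≤ₑ_ : ∀ {u} → El u → El u → Set
    [] ≤ₑ [] = ⊤
    ((x , _) ∷ xs) ≤ₑ ((y , _) ∷ ys) = (x ≤ y) × (xs ≤ₑ ys)

    comps : ∀ {u} → El u → List ℕ
    comps [] = []
    comps ((x , _) ∷ xs) = x ∷ comps xs

maxList : List ℕ → ℕ
maxList = foldr _⊔_ 0

-- φ(ξ) ⊆ ℕ∖{0} nonempty for each 1-cell ξ; φ(u ⋆₀ v) = φ(u) × φ(v) so
-- φ(u) is the product of the φ(ξ) (elements are tuples); each 2-cell is
-- sent to a monotone map; 2-paths are interpreted functorially.
record Interp (S : Sig) : Set₁ where
  open Sig S
  field
    dom     : Fin n1 → ℕ → Set
    dom-pos : ∀ ξ x → dom ξ x → 1 ≤ x
    dom-ne  : ∀ ξ → ∃ (dom ξ)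
  open Carriers {S} dom public
  field
    cellMap  : ∀ {u v} → Cell2 S u v → El u → El v
    cellMono : ∀ {u v} (c : Cell2 S u v) {x y : El u} →
               x ≤ₑ y → cellMap c x ≤ₑ cellMap c y

  ⟦_⟧ : ∀ {u v} → Path2 S u v → El u → El v
  ⟦ cell c ⟧ x = cellMap c x
  ⟦ idp u ⟧ x = x
  ⟦ _⋆₀_ {u} p q ⟧ x = ++⁺ (⟦ p ⟧ (proj₁ (++⁻ u x))) (⟦ q ⟧ (proj₂ (++⁻ u x)))
  ⟦ p ⋆₁ q ⟧ x = ⟦ q ⟧ (⟦ p ⟧ x)

  ∂ : ∀ {u v} → Path2 S u v → El u → ℕ
  ∂ (cell c) x = maxList (comps x ++ comps (cellMap c x))
  ∂ (idp u) x = 0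
  ∂ (_⋆₀_ {u} p q) x = ∂ p (proj₁ (++⁻ u x)) ⊔ ∂ q (proj₂ (++⁻ u x))
  ∂ (p ⋆₁ q) x = ∂ p x ⊔ ∂ q (⟦ p ⟧ x)

Additive : {S : Sig} → Interp S → Set
Additive {S} φ =
  Σ (Fin (Sig.nc S) → ℕ) λ cst →
    (∀ c → 1 ≤ cst c) ×
    (∀ c (x : El (Sig.conSrc S c)) →
       proj₁ (head (cellMap (con c) x)) ≡ foldr _+_ 0 (comps x) + cst c)
  where open Interp φ

-- A constructor cell never decreases the largest component of its input,
-- since by additivity its output is their sum plus c_c.  Hence along a value
-- t every number that ∂_φ t sees is bounded by the largest component of
-- φ(t)(x), and that component is already counted by ∂_φ f at φ(t)(x).

{-# OPTIONS --safe #-}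
module Submission where

open import Defs
open import Data.Fin using (Fin)
open import Data.List using ([]; _∷_; _++_)
open import Data.List.Relation.Unary.All using ([]; _∷_)
open import Data.List.Relation.Unary.All.Properties using (++⁺; ++⁻)
open import Data.Nat using (ℕ; _+_; _≤_; _⊔_; z≤n)
open import Data.Nat.ListAction using (sum)
open import Data.Nat.Properties
open import Data.Product using (_,_; proj₁; proj₂)
open import Relation.Binary.PropositionalEquality using (_≡_; refl; cong; sym; trans; module ≡-Reasoning)

maxList-++ : ∀ ms ns → maxList (ms ++ ns) ≡ maxList ms ⊔ maxList ns
maxList-++ []       ns = refl
maxList-++ (m ∷ ms) ns = begin
  m ⊔ maxList (ms ++ ns)            ≡⟨ cong (m ⊔_) (maxList-++ ms ns) ⟩
  m ⊔ (maxList ms ⊔ maxList ns)     ≡⟨ sym (⊔-assoc m _ _) ⟩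
  m ⊔ maxList ms ⊔ maxList ns       ∎
  where open ≡-Reasoning

maxList≤sum : ∀ ns → maxList ns ≤ sum ns
maxList≤sum []       = z≤n
maxList≤sum (n ∷ ns) = ≤-trans (⊔-monoʳ-≤ n (maxList≤sum ns)) (m⊔n≤m+n n (sum ns))

module _ {S : Sig} (φ : Interp S) where
  open Sig S
  open Interp φ

  maxₑ : ∀ {u} → El u → ℕ
  maxₑ x = maxList (comps x)

  comps-++⁺ : ∀ {u v} (a : El u) (b : El v) → comps (++⁺ a b) ≡ comps a ++ comps b
  comps-++⁺ []            b = refl
  comps-++⁺ ((m , _) ∷ a) b = cong (m ∷_) (comps-++⁺ a b)

  comps-++⁻ : ∀ u {v} (x : El (u ++ v)) →
              comps x ≡ comps (proj₁ (++⁻ u x)) ++ comps (proj₂ (++⁻ u x))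
  comps-++⁻ []      x             = refl
  comps-++⁻ (_ ∷ u) ((m , _) ∷ x) = cong (m ∷_) (comps-++⁻ u x)

  maxₑ-++⁺ : ∀ {u v} (a : El u) (b : El v) → maxₑ (++⁺ a b) ≡ maxₑ a ⊔ maxₑ b
  maxₑ-++⁺ a b = trans (cong maxList (comps-++⁺ a b)) (maxList-++ (comps a) (comps b))

  maxₑ-++⁻ : ∀ u {v} (x : El (u ++ v)) →
             maxₑ x ≡ maxₑ (proj₁ (++⁻ u x)) ⊔ maxₑ (proj₂ (++⁻ u x))
  maxₑ-++⁻ u x = trans (cong maxList (comps-++⁻ u x))
                       (maxList-++ (comps (proj₁ (++⁻ u x))) (comps (proj₂ (++⁻ u x))))

  ∂-cell : ∀ {u v} (c : Cell2 S u v) (x : El u) → ∂ (cell c) x ≡ maxₑ x ⊔ maxₑ (cellMap c x)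
  ∂-cell c x = maxList-++ (comps x) (comps (cellMap c x))

  MaxInflationary : ∀ {u v} → (El u → El v) → Set
  MaxInflationary g = ∀ x → maxₑ x ≤ maxₑ (g x)

  additive⇒con-maxInflationary : Additive φ → ∀ c → MaxInflationary (cellMap (con c))
  additive⇒con-maxInflationary (cst , _ , con≡sum+cst) c x
    with cellMap (con c) x | con≡sum+cst c x
  ... | (m , _) ∷ [] | m≡sum+cst = begin
    maxₑ x                 ≤⟨ maxList≤sum (comps x) ⟩
    sum (comps x)          ≤⟨ m≤m+n (sum (comps x)) (cst c) ⟩
    sum (comps x) + cst c  ≡⟨ sym m≡sum+cst ⟩
    m                      ≡⟨ sym (⊔-identityʳ m) ⟩
    m ⊔ 0                  ∎
    where open ≤-Reasoning

  module _ (con-infl : ∀ c → MaxInflationary (cellMap (con c))) where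

    ⟦⟧-maxInflationary : ∀ {u v} {p : Path2 S u v} → OnlyCons S p → MaxInflationary ⟦ p ⟧
    ⟦⟧-maxInflationary (con-c c)   x = con-infl c x
    ⟦⟧-maxInflationary (id-c u)    x = ≤-refl
    ⟦⟧-maxInflationary (⋆₀-c {u} {p = p} {q} cp cq) x = begin
      maxₑ x                                   ≡⟨ maxₑ-++⁻ u x ⟩
      maxₑ x₁ ⊔ maxₑ x₂                        ≤⟨ ⊔-mono-≤ (⟦⟧-maxInflationary cp x₁)
                                                            (⟦⟧-maxInflationary cq x₂) ⟩
      maxₑ (⟦ p ⟧ x₁) ⊔ maxₑ (⟦ q ⟧ x₂)        ≡⟨ sym (maxₑ-++⁺ (⟦ p ⟧ x₁) (⟦ q ⟧ x₂)) ⟩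
      maxₑ (⟦ p ⋆₀ q ⟧ x)                      ∎
      where
      open ≤-Reasoning
      x₁ = proj₁ (++⁻ u x)
      x₂ = proj₂ (++⁻ u x)
    ⟦⟧-maxInflationary (⋆₁-c cp cq) x =
      ≤-trans (⟦⟧-maxInflationary cp x) (⟦⟧-maxInflationary cq _)

    ∂≤maxₑ-⟦⟧ : ∀ {u v} {p : Path2 S u v} → OnlyCons S p → ∀ x → ∂ p x ≤ maxₑ (⟦ p ⟧ x)
    ∂≤maxₑ-⟦⟧ (con-c c) x rewrite ∂-cell (con c) x = ⊔-lub (con-infl c x) ≤-refl
    ∂≤maxₑ-⟦⟧ (id-c u)  x = z≤n
    ∂≤maxₑ-⟦⟧ (⋆₀-c {u} {p = p} {q} cp cq) x = begin
      ∂ p x₁ ⊔ ∂ q x₂                          ≤⟨ ⊔-mono-≤ (∂≤maxₑ-⟦⟧ cp x₁) (∂≤maxₑ-⟦⟧ cq x₂) ⟩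
      maxₑ (⟦ p ⟧ x₁) ⊔ maxₑ (⟦ q ⟧ x₂)        ≡⟨ sym (maxₑ-++⁺ (⟦ p ⟧ x₁) (⟦ q ⟧ x₂)) ⟩
      maxₑ (⟦ p ⋆₀ q ⟧ x)                      ∎
      where
      open ≤-Reasoning
      x₁ = proj₁ (++⁻ u x)
      x₂ = proj₂ (++⁻ u x)
    ∂≤maxₑ-⟦⟧ (⋆₁-c cp cq) x =
      ⊔-lub (≤-trans (∂≤maxₑ-⟦⟧ cp x) (⟦⟧-maxInflationary cq _)) (∂≤maxₑ-⟦⟧ cq _)

    ∂-cons-⋆₁-cell : ∀ {u v w} {t : Path2 S u v} → OnlyCons S t → (c : Cell2 S v w) →
                     ∀ x → ∂ (t ⋆₁ cell c) x ≡ ∂ (cell c) (⟦ t ⟧ x)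
    ∂-cons-⋆₁-cell {t = t} ct c x = m≤n⇒m⊔n≡n (begin
      ∂ t x                                     ≤⟨ ∂≤maxₑ-⟦⟧ ct x ⟩
      maxₑ (⟦ t ⟧ x)                            ≤⟨ m≤m⊔n _ _ ⟩
      maxₑ (⟦ t ⟧ x) ⊔ maxₑ (cellMap c (⟦ t ⟧ x)) ≡⟨ sym (∂-cell c (⟦ t ⟧ x)) ⟩
      ∂ (cell c) (⟦ t ⟧ x)                      ∎)
      where open ≤-Reasoning

proposition3p6 : (P : Program) (φ : Interp (Program.sig P)) → Additive φ →
    (f : Fin (Sig.nf (Program.sig P)))
    (t : Path2 (Program.sig P) [] (Sig.funSrc (Program.sig P) f)) →
    IsValue (Program.sig P) t →
    (x : Interp.El φ []) →
    Interp.∂ φ (t ⋆₁ cell (fun f)) x ≡ Interp.∂ φ (cell (fun f)) (Interp.⟦_⟧ φ t x)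
proposition3p6 P φ additive f t t-value =
  ∂-cons-⋆₁-cell φ (additive⇒con-maxInflationary φ additive) t-value (fun f)
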